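{- Assume the following statement (Conjecture 2): for every positive integer $n$ and every system $\mathcal{S} \subseteq G_n$, if $\mathcal{S}$ has only finitely many solutions in non-negative rationals $x_1,\ldots,x_n$, then each such solution satisfies $h(x_1,\ldots,x_n) \leqslant f(2n)$. If a Diophantine equation $D(x_1,\ldots,x_p)=0$ has only finitely many rational solutions, then an upper bound for their heights can be computed, namely by computing an upper bound for the heights of the (finitely many) solutions in non-negative rationals of the equation \[ \prod_{(i_1,\ldots,i_p)\in\{1,2\}^p} D\bigl((-1)^{i_1}x_1,\ldots,(-1)^{i_p}x_p\bigr)=0 . \]
   Context: The height of a rational number $\frac{p}{q}$ written in lowest terms is $h\left(\frac{p}{q}\right)=\max(|p|,|q|)$; the height of a rational tuple is $h(x_1,\ldots,x_n)=\max(h(x_1),\ldots,h(x_n))$. For a positive integer $n$, $G_n=\{x_i+1=x_k: i,k \in \{1,\ldots,n\}\} \cup \{x_i \cdot x_j=x_k: i,j,k \in \{1,\ldots,n\}\}$. The function $f$ is defined by $f(1)=1$ and $f(n+1)=2^{2^{f(n)}}$ for every positive integer $n$. A Diophantine equation is an equation $D(x_1,\ldots,x_p)=0$ with $D \in \mathbb{Z}[x_1,\ldots,x_p]$. -}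

module Defs where

open import Data.Nat using (ℕ; zero; suc; _^_; _⊔_; _≤_; _*_)
open import Data.Integer as ℤ using (ℤ)
open import Data.Rational as ℚ using (ℚ; 0ℚ; 1ℚ; _/_)
open import Data.Fin using (Fin)
open import Data.Vec using (Vec; lookup; foldr′; map)
open import Data.List using (List)
open import Data.List.Membership.Propositional using (_∈_)
open import Data.List.Relation.Unary.All using (All)
open import Data.Product using (Σ; _×_)
open import Relation.Binary.PropositionalEquality using (_≡_)

-- height of a rational in lowest terms (stdlib ℚ is always normalised)
hℚ : ℚ → ℕ
hℚ q = ℤ.∣ ℚ.↥ q ∣ ⊔ ℚ.↧ₙ q

hVec : {n : ℕ} → Vec ℚ n → ℕ
hVec xs = foldr′ _⊔_ 0 (map hℚ xs)

-- f(1) = 1, f(n+1) = 2^(2^f(n)); f 0 is an unused junk value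
f : ℕ → ℕ
f zero = 0
f (suc zero) = 1
f (suc (suc n)) = 2 ^ (2 ^ f (suc n))

data GEq (n : ℕ) : Set where
  addOne : Fin n → Fin n → GEq n          -- x_i + 1 = x_k
  mulEq  : Fin n → Fin n → Fin n → GEq n  -- x_i * x_j = x_k

GSystem : ℕ → Set
GSystem n = List (GEq n)

SatG : {n : ℕ} → Vec ℚ n → GEq n → Set
SatG x (addOne i k) = lookup x i ℚ.+ 1ℚ ≡ lookup x k
SatG x (mulEq i j k) = lookup x i ℚ.* lookup x j ≡ lookup x k

NonNeg : {n : ℕ} → Vec ℚ n → Set
NonNeg {n} x = (i : Fin n) → 0ℚ ℚ.≤ lookup x i

NonNegSol : {n : ℕ} → GSystem n → Vec ℚ n → Set
NonNegSol S x = NonNeg x × All (SatG x) S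

FinitelyMany : {n : ℕ} → (Vec ℚ n → Set) → Set
FinitelyMany {n} P = Σ (List (Vec ℚ n)) λ L → (x : Vec ℚ n) → P x → x ∈ L

Conjecture2 : Set
Conjecture2 = (n : ℕ) → 1 ≤ n → (S : GSystem n) →
  FinitelyMany (NonNegSol S) →
  (x : Vec ℚ n) → NonNegSol S x → hVec x ≤ f (2 * n)

-- integer polynomials in p variables (every element of ℤ[x_1..x_p] is denoted)
data Poly (p : ℕ) : Set where
  const : ℤ → Poly p
  var   : Fin p → Poly p
  _⊕_   : Poly p → Poly p → Poly p
  _⊗_   : Poly p → Poly p → Poly p

evalℚ : {p : ℕ} → Poly p → Vec ℚ p → ℚ
evalℚ (const c) x = c / 1
evalℚ (var i) x = lookup x i
evalℚ (a ⊕ b) x = evalℚ a x ℚ.+ evalℚ b x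
evalℚ (a ⊗ b) x = evalℚ a x ℚ.* evalℚ b x

RatSol : {p : ℕ} → Poly p → Vec ℚ p → Set
RatSol D x = evalℚ D x ≡ 0ℚ

{-# OPTIONS --safe #-}
-- A rational solution x of D = 0 is determined by its sign vector ε and by
-- y = |x|, a non-negative root of D(ε·y) = P_ε(y) − Q_ε(y) where P_ε and Q_ε
-- have natural coefficients. Evaluate P_ε and Q_ε by a straight-line program
-- of steps u + 1, u·v and u + v, each written with equations of G_n that
-- determine the new unknowns among the non-negative rationals (u + v goes
-- through t = u/(v + 1)), and add P_ε · 1 = Q_ε: the non-negative solutions of
-- the resulting system S_ε ⊆ G_n are exactly the runs of the program on such
-- roots y. So S_ε has finitely many solutions, Conjecture 2 bounds their
-- heights by f(2n_ε), and y occurs among the unknowns. The maximum over the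
-- 2^p sign vectors plays the role of the product over sign patterns.
module Submission where

open import Defs
open import Data.Nat using (ℕ; _≤_; _⊔_; z≤n; s≤s)
open import Data.Rational using (ℚ)
open import Data.Vec using (Vec)
open import Data.Product using (Σ)

open import Algebra.Properties.Group using (∙-cancelʳ)
open import Data.Bool using (Bool; true; false)
open import Data.Fin using (Fin; zero; suc; _↑ʳ_)
open import Data.Integer as ℤ using (+_; +0; -[1+_]; +[1+_])
import Data.Integer.Solver as ℤSolver
open import Data.List using (List; []; _∷_; [_]; map) renaming (_++_ to _++ₗ_)
open import Data.List.Membership.Propositional using (_∈_)
open import Data.List.Membership.Propositional.Properties using (∈-map⁺)
open import Data.List.Relation.Unary.All as All using (All; []; _∷_)
import Data.List.Relation.Unary.All.Properties as All
import Data.Nat as ℕ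
import Data.Nat.Properties as ℕP
open import Data.Product using (_×_; _,_; proj₁; proj₂)
open import Data.Rational as ℚ using (mkℚ; 0ℚ; 1ℚ; _/_)
import Data.Rational.Properties as ℚP
open import Data.Rational.Solver using (module +-*-Solver)
import Data.Rational.Unnormalised as ℚᵘ
import Data.Rational.Unnormalised.Properties as ℚᵘP
open import Data.Vec using ([]; _∷_; lookup; _++_; tabulate; zipWith; splitAt)
import Data.Vec as Vec
import Data.Vec.Properties as VecP
open import Function using (_∘_; id)
open import Relation.Binary.PropositionalEquality using (_≡_; refl; sym; trans; cong; cong₂; subst; module ≡-Reasoning)

0≤p+q : ∀ {p q} → 0ℚ ℚ.≤ p → 0ℚ ℚ.≤ q → 0ℚ ℚ.≤ p ℚ.+ q
0≤p+q = ℚP.+-mono-≤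

0≤p*q : ∀ {p q} → 0ℚ ℚ.≤ p → 0ℚ ℚ.≤ q → 0ℚ ℚ.≤ p ℚ.* q
0≤p*q {p} {q} 0≤p 0≤q =
  subst (ℚ._≤ p ℚ.* q) (ℚP.*-zeroʳ p) (ℚP.*-monoˡ-≤-nonNeg p {{ℚ.nonNegative 0≤p}} 0≤q)

0<p+1 : ∀ {p} → 0ℚ ℚ.≤ p → 0ℚ ℚ.< p ℚ.+ 1ℚ
0<p+1 0≤p = ℚP.+-mono-≤-< 0≤p (ℚP.positive⁻¹ 1ℚ)

0≤p+1 : ∀ {p} → 0ℚ ℚ.≤ p → 0ℚ ℚ.≤ p ℚ.+ 1ℚ
0≤p+1 = ℚP.<⇒≤ ∘ 0<p+1

-- A total reciprocal, with junk value 0 on non-positive arguments, so that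
-- the witness of the addition gadget below needs no positivity proof.
recip : ℚ → ℚ
recip p@(mkℚ +[1+ _ ] _ _) = ℚ.1/ p
recip _ = 0ℚ

0≤recip : ∀ p → 0ℚ ℚ.≤ recip p
0≤recip p@(mkℚ +[1+ _ ] _ _) = ℚP.nonNegative⁻¹ (recip p)
0≤recip (mkℚ +0 _ _) = ℚP.≤-refl
0≤recip (mkℚ -[1+ _ ] _ _) = ℚP.≤-refl

p*recip[p]≡1 : ∀ {p} → 0ℚ ℚ.< p → p ℚ.* recip p ≡ 1ℚ
p*recip[p]≡1 {p@(mkℚ +[1+ _ ] _ _)} _ = ℚP.*-inverseʳ p
p*recip[p]≡1 {mkℚ +0 _ _} (ℚ.*<* (ℤ.+<+ ()))
p*recip[p]≡1 {mkℚ -[1+ _ ] _ _} (ℚ.*<* ())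

a*recip[b]*b≡a : ∀ a {b} → 0ℚ ℚ.< b → a ℚ.* recip b ℚ.* b ≡ a
a*recip[b]*b≡a a {b} 0<b = begin
  a ℚ.* recip b ℚ.* b   ≡⟨ ℚP.*-assoc a (recip b) b ⟩
  a ℚ.* (recip b ℚ.* b) ≡⟨ cong (a ℚ.*_) (ℚP.*-comm (recip b) b) ⟩
  a ℚ.* (b ℚ.* recip b) ≡⟨ cong (a ℚ.*_) (p*recip[p]≡1 0<b) ⟩
  a ℚ.* 1ℚ              ≡⟨ ℚP.*-identityʳ a ⟩
  a                     ∎
  where open ≡-Reasoning

t*b≡a⇒t≡a*recip[b] : ∀ {t a b} → 0ℚ ℚ.< b → t ℚ.* b ≡ a → t ≡ a ℚ.* recip b
t*b≡a⇒t≡a*recip[b] {t} {a} {b} 0<b t*b≡a = begin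
  t                         ≡⟨ ℚP.*-identityʳ t ⟨
  t ℚ.* 1ℚ                  ≡⟨ cong (t ℚ.*_) (p*recip[p]≡1 0<b) ⟨
  t ℚ.* (b ℚ.* recip b)     ≡⟨ ℚP.*-assoc t b (recip b) ⟨
  t ℚ.* b ℚ.* recip b       ≡⟨ cong (ℚ._* recip b) t*b≡a ⟩
  a ℚ.* recip b             ∎
  where open ≡-Reasoning

p*p≡p⇒p≡1 : ∀ {p} → 0ℚ ℚ.< p → p ℚ.* p ≡ p → p ≡ 1ℚ
p*p≡p⇒p≡1 0<p p*p≡p = trans (t*b≡a⇒t≡a*recip[b] 0<p p*p≡p) (p*recip[p]≡1 0<p)

p+1≡q+1⇒p≡q : ∀ {p q} → p ℚ.+ 1ℚ ≡ q ℚ.+ 1ℚ → p ≡ q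
p+1≡q+1⇒p≡q = ∙-cancelʳ ℚP.+-0-group 1ℚ _ _

[1+n]/1≡n/1+1 : ∀ n → + ℕ.suc n / 1 ≡ + n / 1 ℚ.+ 1ℚ
[1+n]/1≡n/1+1 n = ℚP.toℚᵘ-injective (begin
  ℚ.toℚᵘ (+ ℕ.suc n / 1)                ≈⟨ ℚP.toℚᵘ-fromℚᵘ (ℚᵘ.mkℚᵘ (+ ℕ.suc n) 0) ⟩
  ℚᵘ.mkℚᵘ (+ ℕ.suc n) 0                 ≈⟨ ℚᵘ.*≡* (solve 1 (λ m →
    (con (+ 1) :+ m) :* (con (+ 1) :* con (+ 1)) :=
    (m :* con (+ 1) :+ con (+ 1) :* con (+ 1)) :* con (+ 1)) refl (+ n)) ⟩
  ℚᵘ.mkℚᵘ (+ n) 0 ℚᵘ.+ ℚ.toℚᵘ 1ℚ      ≈⟨ ℚᵘP.+-congˡ (ℚ.toℚᵘ 1ℚ) (ℚP.toℚᵘ-fromℚᵘ (ℚᵘ.mkℚᵘ (+ n) 0)) ⟨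
  ℚ.toℚᵘ (+ n / 1) ℚᵘ.+ ℚ.toℚᵘ 1ℚ     ≈⟨ ℚP.toℚᵘ-homo-+ (+ n / 1) 1ℚ ⟨
  ℚ.toℚᵘ (+ n / 1 ℚ.+ 1ℚ)             ∎)
  where
  open ℚᵘP.≃-Reasoning
  open ℤSolver.+-*-Solver

renameG : ∀ {k n} → (Fin k → Fin n) → GEq k → GEq n
renameG ρ (addOne i k) = addOne (ρ i) (ρ k)
renameG ρ (mulEq i j k) = mulEq (ρ i) (ρ j) (ρ k)

module _ {k n} {ρ : Fin k → Fin n} {ys : Vec ℚ n} {xs : Vec ℚ k}
         (agree : ∀ j → lookup ys (ρ j) ≡ lookup xs j) where

  SatG-renameG : ∀ e → SatG ys (renameG ρ e) ≡ SatG xs e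
  SatG-renameG (addOne i k) rewrite agree i | agree k = refl
  SatG-renameG (mulEq i j k) rewrite agree i | agree j | agree k = refl

  All-SatG-renameG⁺ : ∀ {es} → All (SatG xs) es → All (SatG ys) (map (renameG ρ) es)
  All-SatG-renameG⁺ = All.map⁺ ∘ All.map (λ {e} → subst id (sym (SatG-renameG e)))

  All-SatG-renameG⁻ : ∀ {es} → All (SatG ys) (map (renameG ρ) es) → All (SatG xs) es
  All-SatG-renameG⁻ = All.map (λ {e} → subst id (SatG-renameG e)) ∘ All.map⁻

NonNeg-++ : ∀ {m n} (ys : Vec ℚ m) {xs : Vec ℚ n} → NonNeg ys → NonNeg xs → NonNeg (ys ++ xs)
NonNeg-++ [] _ 0≤xs = 0≤xs
NonNeg-++ (y ∷ ys) 0≤ys 0≤xs zero = 0≤ys zero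
NonNeg-++ (y ∷ ys) 0≤ys 0≤xs (suc j) = NonNeg-++ ys (0≤ys ∘ suc) 0≤xs j

data Instr (k : ℕ) : Set where
  incr    : Fin k → Instr k
  mult    : Fin k → Fin k → Instr k
  add     : Fin k → Fin k → Instr k
  zeroOne : Instr k

scratch : ∀ {k} → Instr k → ℕ
scratch (incr _)   = 0
scratch (mult _ _) = 0
scratch (add _ _)  = 4
scratch zeroOne    = 1

-- An instruction puts its result, followed by its scratch registers, in front
-- of the old registers.
width : ∀ {k} → Instr k → ℕ
width i = ℕ.suc (scratch i)

outputs : ∀ {k} (i : Instr k) → Vec ℚ k → Vec ℚ (width i)
outputs (incr a) xs = lookup xs a ℚ.+ 1ℚ ∷ []
outputs (mult a b) xs = lookup xs a ℚ.* lookup xs b ∷ []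
outputs (add a b) xs = u ℚ.+ v ∷ u ℚ.+ v ℚ.+ 1ℚ ∷ u ℚ.* recip (v ℚ.+ 1ℚ) ℚ.+ 1ℚ
                     ∷ u ℚ.* recip (v ℚ.+ 1ℚ) ∷ v ℚ.+ 1ℚ ∷ []
  where u = lookup xs a; v = lookup xs b
outputs zeroOne xs = 0ℚ ∷ 1ℚ ∷ []

-- G_n has neither addition nor constants: c = u + v is expressed by
-- B = v + 1, t · B = u, s = t + 1, s · B = C, c + 1 = C, which forces
-- t = u / (v + 1) and C = u + v + 1 once v ≥ 0; and z + 1 = w, w · w = w
-- forces w = 1 and z = 0 once z ≥ 0.
equations : ∀ {k} (i : Instr k) → List (GEq (width i ℕ.+ k))
equations (incr a) = [ addOne (1 ↑ʳ a) zero ]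
equations (mult a b) = [ mulEq (1 ↑ʳ a) (1 ↑ʳ b) zero ]
equations (add a b) =
  addOne (5 ↑ʳ b) B ∷ mulEq t B (5 ↑ʳ a) ∷ addOne t s ∷ mulEq s B C ∷ addOne c C ∷ []
  where
  c C s t B : Fin (5 ℕ.+ _)
  c = zero; C = suc zero; s = suc (suc zero); t = suc (suc (suc zero))
  B = suc (suc (suc (suc zero)))
equations zeroOne = addOne zero (suc zero) ∷ mulEq (suc zero) (suc zero) (suc zero) ∷ []

[t+1]*[v+1]≡u+v+1 : ∀ t {u} v → t ℚ.* (v ℚ.+ 1ℚ) ≡ u → (t ℚ.+ 1ℚ) ℚ.* (v ℚ.+ 1ℚ) ≡ u ℚ.+ v ℚ.+ 1ℚ
[t+1]*[v+1]≡u+v+1 t {u} v t*[v+1]≡u = begin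
  (t ℚ.+ 1ℚ) ℚ.* (v ℚ.+ 1ℚ)          ≡⟨ distrib t v ⟩
  t ℚ.* (v ℚ.+ 1ℚ) ℚ.+ (v ℚ.+ 1ℚ)    ≡⟨ cong (ℚ._+ (v ℚ.+ 1ℚ)) t*[v+1]≡u ⟩
  u ℚ.+ (v ℚ.+ 1ℚ)                   ≡⟨ ℚP.+-assoc u v 1ℚ ⟨
  u ℚ.+ v ℚ.+ 1ℚ                     ∎
  where
  open ≡-Reasoning
  open +-*-Solver
  distrib : ∀ t v → (t ℚ.+ 1ℚ) ℚ.* (v ℚ.+ 1ℚ) ≡ t ℚ.* (v ℚ.+ 1ℚ) ℚ.+ (v ℚ.+ 1ℚ)
  distrib = solve 2 (λ t v → (t :+ con 1ℚ) :* (v :+ con 1ℚ) := t :* (v :+ con 1ℚ) :+ (v :+ con 1ℚ)) refl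

outputs-satisfy : ∀ {k} (i : Instr k) xs → NonNeg xs → All (SatG (outputs i xs ++ xs)) (equations i)
outputs-satisfy (incr a) xs _ = refl ∷ []
outputs-satisfy (mult a b) xs _ = refl ∷ []
outputs-satisfy (add a b) xs 0≤xs =
  refl ∷ t*B≡u ∷ refl ∷ [t+1]*[v+1]≡u+v+1 t (lookup xs b) t*B≡u ∷ refl ∷ []
  where
  t = lookup xs a ℚ.* recip (lookup xs b ℚ.+ 1ℚ)
  t*B≡u = a*recip[b]*b≡a (lookup xs a) (0<p+1 (0≤xs b))
outputs-satisfy zeroOne xs _ = refl ∷ refl ∷ []

outputs-nonNeg : ∀ {k} (i : Instr k) {xs} → NonNeg xs → NonNeg (outputs i xs)
outputs-nonNeg (incr a) 0≤xs zero = 0≤p+1 (0≤xs a)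
outputs-nonNeg (mult a b) 0≤xs zero = 0≤p*q (0≤xs a) (0≤xs b)
outputs-nonNeg (add a b) 0≤xs zero = 0≤p+q (0≤xs a) (0≤xs b)
outputs-nonNeg (add a b) 0≤xs (suc zero) = 0≤p+1 (0≤p+q (0≤xs a) (0≤xs b))
outputs-nonNeg (add a b) {xs} 0≤xs (suc (suc zero)) = 0≤p+1 (0≤p*q (0≤xs a) (0≤recip (lookup xs b ℚ.+ 1ℚ)))
outputs-nonNeg (add a b) {xs} 0≤xs (suc (suc (suc zero))) = 0≤p*q (0≤xs a) (0≤recip (lookup xs b ℚ.+ 1ℚ))
outputs-nonNeg (add a b) 0≤xs (suc (suc (suc (suc zero)))) = 0≤p+1 (0≤xs b)
outputs-nonNeg zeroOne 0≤xs zero = ℚP.≤-refl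
outputs-nonNeg zeroOne 0≤xs (suc zero) = ℚP.<⇒≤ (ℚP.positive⁻¹ 1ℚ)

outputs-unique : ∀ {k} (i : Instr k) ys xs → NonNeg (ys ++ xs) →
                 All (SatG (ys ++ xs)) (equations i) → ys ≡ outputs i xs
outputs-unique (incr a) (_ ∷ []) xs _ (refl ∷ []) = refl
outputs-unique (mult a b) (_ ∷ []) xs _ (refl ∷ []) = refl
outputs-unique (add a b) (c ∷ C ∷ s ∷ t ∷ B ∷ []) xs 0≤ys++xs
               (refl ∷ t*B≡u ∷ refl ∷ refl ∷ c+1≡C ∷ [])
  with t*b≡a⇒t≡a*recip[b] {t} (0<p+1 (0≤ys++xs (5 ↑ʳ b))) t*B≡u
... | refl = cong₂ _∷_ (p+1≡q+1⇒p≡q (trans c+1≡C C≡u+v+1)) (cong (_∷ s ∷ t ∷ B ∷ []) C≡u+v+1)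
  where
  C≡u+v+1 = [t+1]*[v+1]≡u+v+1 t (lookup xs b) (a*recip[b]*b≡a (lookup xs a) (0<p+1 (0≤ys++xs (5 ↑ʳ b))))
outputs-unique zeroOne (z ∷ _ ∷ []) xs 0≤ys++xs (refl ∷ w*w≡w ∷ [])
  with p+1≡q+1⇒p≡q {z} {0ℚ} (p*p≡p⇒p≡1 (0<p+1 (0≤ys++xs zero)) w*w≡w)
... | refl = refl

data Prog (k : ℕ) : ℕ → Set where
  done : Prog k k
  step : ∀ {n} (i : Instr k) → Prog (width i ℕ.+ k) n → Prog k n

run : ∀ {k n} → Prog k n → Vec ℚ k → Vec ℚ n
run done xs = xs
run (step i P) xs = run P (outputs i xs ++ xs)

embed : ∀ {k n} → Prog k n → Fin k → Fin n
embed done j = j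
embed (step i P) j = embed P (width i ↑ʳ j)

progEquations : ∀ {k n} → Prog k n → List (GEq n)
progEquations done = []
progEquations (step i P) = map (renameG (embed P)) (equations i) ++ₗ progEquations P

restrict : ∀ {k n} → Prog k n → Vec ℚ n → Vec ℚ k
restrict P ys = tabulate (lookup ys ∘ embed P)

_⨾_ : ∀ {k n m} → Prog k n → Prog n m → Prog k m
done ⨾ Q = Q
step i P ⨾ Q = step i (P ⨾ Q)

run-⨾ : ∀ {k n m} (P : Prog k n) (Q : Prog n m) xs → run (P ⨾ Q) xs ≡ run Q (run P xs)
run-⨾ done Q xs = refl
run-⨾ (step i P) Q xs = run-⨾ P Q _

Prog⇒≤ : ∀ {k n} → Prog k n → k ≤ n
Prog⇒≤ done = ℕP.≤-refl
Prog⇒≤ (step i P) = ℕP.≤-trans (ℕP.m≤n+m _ (width i)) (Prog⇒≤ P)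

lookup-run-embed : ∀ {k n} (P : Prog k n) xs j → lookup (run P xs) (embed P j) ≡ lookup xs j
lookup-run-embed done xs j = refl
lookup-run-embed (step i P) xs j =
  trans (lookup-run-embed P (outputs i xs ++ xs) (width i ↑ʳ j)) (VecP.lookup-++ʳ (outputs i xs) xs j)

lookup-restrict : ∀ {k n} (P : Prog k n) ys j → lookup (restrict P ys) j ≡ lookup ys (embed P j)
lookup-restrict P ys = VecP.lookup∘tabulate (lookup ys ∘ embed P)

run-nonNeg : ∀ {k n} (P : Prog k n) {xs} → NonNeg xs → NonNeg (run P xs)
run-nonNeg done 0≤xs = 0≤xs
run-nonNeg (step i P) {xs} 0≤xs = run-nonNeg P (NonNeg-++ (outputs i xs) (outputs-nonNeg i 0≤xs) 0≤xs)

run-satisfies : ∀ {k n} (P : Prog k n) xs → NonNeg xs → All (SatG (run P xs)) (progEquations P)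
run-satisfies done xs _ = []
run-satisfies (step i P) xs 0≤xs = All.++⁺
  (All-SatG-renameG⁺ (lookup-run-embed P xs′) (outputs-satisfy i xs 0≤xs))
  (run-satisfies P xs′ (NonNeg-++ (outputs i xs) (outputs-nonNeg i 0≤xs) 0≤xs))
  where xs′ = outputs i xs ++ xs

run-unique : ∀ {k n} (P : Prog k n) ys → NonNeg ys → All (SatG ys) (progEquations P) →
             ys ≡ run P (restrict P ys)
run-unique done ys _ _ = sym (VecP.tabulate∘lookup ys)
run-unique (step i P) ys 0≤ys sat = begin
  ys                             ≡⟨ run-unique P ys 0≤ys (All.++⁻ʳ _ sat) ⟩
  run P xs′                      ≡⟨ cong (run P) xs′≡new++old ⟩
  run P (new ++ old)             ≡⟨ cong (λ v → run P (v ++ old)) new≡outputs ⟩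
  run (step i P) old             ≡⟨ cong (run (step i P)) restrict≡old ⟨
  run (step i P) (restrict (step i P) ys) ∎
  where
  open ≡-Reasoning
  xs′ = restrict P ys
  new = proj₁ (splitAt (width i) xs′)
  old = proj₁ (proj₂ (splitAt (width i) xs′))
  xs′≡new++old = proj₂ (proj₂ (splitAt (width i) xs′))
  xs′-sat : All (SatG xs′) (equations i)
  xs′-sat = All-SatG-renameG⁻ (λ j → sym (lookup-restrict P ys j)) (All.++⁻ˡ _ sat)
  0≤xs′ : NonNeg xs′
  0≤xs′ j = subst (0ℚ ℚ.≤_) (sym (lookup-restrict P ys j)) (0≤ys (embed P j))
  new≡outputs : new ≡ outputs i old
  new≡outputs = outputs-unique i new old (subst NonNeg xs′≡new++old 0≤xs′)
    (subst (λ v → All (SatG v) (equations i)) xs′≡new++old xs′-sat)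
  restrict≡old : restrict (step i P) ys ≡ old
  restrict≡old = trans
    (VecP.tabulate-cong λ j → trans (sym (lookup-restrict P ys (width i ↑ʳ j)))
      (trans (cong (λ v → lookup v (width i ↑ʳ j)) xs′≡new++old) (VecP.lookup-++ʳ new old j)))
    (VecP.tabulate∘lookup old)

infixl 6 _⊞_
infixl 7 _⊠_

data NatPoly (p : ℕ) : Set where
  num     : ℕ → NatPoly p
  var     : Fin p → NatPoly p
  _⊞_ _⊠_ : NatPoly p → NatPoly p → NatPoly p

evalNat : ∀ {p} → NatPoly p → (Fin p → ℚ) → ℚ
evalNat (num n) _ = + n / 1
evalNat (var i) env = env i
evalNat (a ⊞ b) env = evalNat a env ℚ.+ evalNat b env
evalNat (a ⊠ b) env = evalNat a env ℚ.* evalNat b env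

evalNat-cong : ∀ {p} (e : NatPoly p) {g h : Fin p → ℚ} → (∀ i → g i ≡ h i) → evalNat e g ≡ evalNat e h
evalNat-cong (num n) _ = refl
evalNat-cong (var i) g≗h = g≗h i
evalNat-cong (a ⊞ b) g≗h = cong₂ ℚ._+_ (evalNat-cong a g≗h) (evalNat-cong b g≗h)
evalNat-cong (a ⊠ b) g≗h = cong₂ ℚ._*_ (evalNat-cong a g≗h) (evalNat-cong b g≗h)

record Compiled (k : ℕ) : Set where
  constructor compiled
  field
    {size}  : ℕ
    program : Prog k size
    result  : Fin size
open Compiled

value : ∀ {k} → Compiled k → Vec ℚ k → ℚ
value o xs = lookup (run (program o) xs) (result o)

data BinOp : Set where
  plus times : BinOp

binInstr : ∀ {n} → BinOp → Fin n → Fin n → Instr n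
binInstr plus  = add
binInstr times = mult

binOp : BinOp → ℚ → ℚ → ℚ
binOp plus  = ℚ._+_
binOp times = ℚ._*_

combine : ∀ {k} → BinOp → (o₁ : Compiled k) → Compiled (size o₁) → Compiled k
combine op (compiled P₁ r₁) (compiled P₂ r₂) =
  compiled (P₁ ⨾ (P₂ ⨾ step (binInstr op (embed P₂ r₁) r₂) done)) zero

value-combine : ∀ {k} op (o₁ : Compiled k) o₂ xs →
  value (combine op o₁ o₂) xs ≡ binOp op (value o₁ xs) (value o₂ (run (program o₁) xs))
value-combine op (compiled P₁ r₁) (compiled P₂ r₂) xs = begin
  lookup (run (P₁ ⨾ (P₂ ⨾ last)) xs) zero ≡⟨ cong (λ v → lookup v zero) (run-⨾ P₁ (P₂ ⨾ last) xs) ⟩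
  lookup (run (P₂ ⨾ last) ys₁) zero      ≡⟨ cong (λ v → lookup v zero) (run-⨾ P₂ last ys₁) ⟩
  lookup (run last ys₂) zero             ≡⟨ first-output op ⟩
  binOp op (lookup ys₂ (embed P₂ r₁)) (lookup ys₂ r₂)
    ≡⟨ cong (λ u → binOp op u (lookup ys₂ r₂)) (lookup-run-embed P₂ ys₁ r₁) ⟩
  binOp op (lookup ys₁ r₁) (lookup ys₂ r₂) ∎
  where
  open ≡-Reasoning
  last = step (binInstr op (embed P₂ r₁) r₂) done
  ys₁ = run P₁ xs
  ys₂ = run P₂ ys₁
  first-output : ∀ op → lookup (run (step (binInstr op (embed P₂ r₁) r₂) done) ys₂) zero
                        ≡ binOp op (lookup ys₂ (embed P₂ r₁)) (lookup ys₂ r₂)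
  first-output plus  = refl
  first-output times = refl

-- env says where the variables live, and z is a register holding 0,
-- from which the constants are built.
compile : ∀ {p k} → NatPoly p → (Fin p → Fin k) → Fin k → Compiled k
compile (num ℕ.zero) env z = compiled done z
compile (num (ℕ.suc c)) env z =
  let o = compile (num c) env z in compiled (program o ⨾ step (incr (result o)) done) zero
compile (var i) env z = compiled done (env i)
compile (a ⊞ b) env z =
  let o = compile a env z in combine plus o (compile b (embed (program o) ∘ env) (embed (program o) z))
compile (a ⊠ b) env z =
  let o = compile a env z in combine times o (compile b (embed (program o) ∘ env) (embed (program o) z))

compile-correct : ∀ {p k} (e : NatPoly p) (env : Fin p → Fin k) z xs → lookup xs z ≡ 0ℚ →
                  value (compile e env z) xs ≡ evalNat e (lookup xs ∘ env)

compile-correct-second : ∀ {p k} (a b : NatPoly p) (env : Fin p → Fin k) z xs → lookup xs z ≡ 0ℚ →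
  let P = program (compile a env z) in
  value (compile b (embed P ∘ env) (embed P z)) (run P xs) ≡ evalNat b (lookup xs ∘ env)
compile-correct-second a b env z xs xs[z]≡0 = trans
  (compile-correct b (embed P ∘ env) (embed P z) (run P xs) (trans (lookup-run-embed P xs z) xs[z]≡0))
  (evalNat-cong b (lookup-run-embed P xs ∘ env))
  where P = program (compile a env z)

compile-correct (num ℕ.zero) env z xs xs[z]≡0 = xs[z]≡0
compile-correct (num (ℕ.suc c)) env z xs xs[z]≡0 = begin
  lookup (run (program o ⨾ step (incr (result o)) done) xs) zero
    ≡⟨ cong (λ v → lookup v zero) (run-⨾ (program o) (step (incr (result o)) done) xs) ⟩
  value o xs ℚ.+ 1ℚ ≡⟨ cong (ℚ._+ 1ℚ) (compile-correct (num c) env z xs xs[z]≡0) ⟩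
  + c / 1 ℚ.+ 1ℚ    ≡⟨ [1+n]/1≡n/1+1 c ⟨
  + ℕ.suc c / 1     ∎
  where
  open ≡-Reasoning
  o = compile (num c) env z
compile-correct (var i) env z xs _ = refl
compile-correct (a ⊞ b) env z xs xs[z]≡0 =
  trans (value-combine plus (compile a env z) _ xs)
        (cong₂ ℚ._+_ (compile-correct a env z xs xs[z]≡0) (compile-correct-second a b env z xs xs[z]≡0))
compile-correct (a ⊠ b) env z xs xs[z]≡0 =
  trans (value-combine times (compile a env z) _ xs)
        (cong₂ ℚ._*_ (compile-correct a env z xs xs[z]≡0) (compile-correct-second a b env z xs xs[z]≡0))

applySign : Bool → ℚ → ℚ
applySign true  q = q
applySign false q = ℚ.- q

signOf : ℚ → Bool
signOf (mkℚ (+ _) _ _)    = true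
signOf (mkℚ -[1+ _ ] _ _) = false

applySign-signOf-∣∣ : ∀ q → applySign (signOf q) ℚ.∣ q ∣ ≡ q
applySign-signOf-∣∣ (mkℚ (+ _) _ _)    = refl
applySign-signOf-∣∣ (mkℚ -[1+ _ ] _ _) = refl

∣applySign∣ : ∀ s {q} → 0ℚ ℚ.≤ q → ℚ.∣ applySign s q ∣ ≡ q
∣applySign∣ true  0≤q = ℚP.0≤p⇒∣p∣≡p 0≤q
∣applySign∣ false {q} 0≤q = trans (ℚP.∣-p∣≡∣p∣ q) (ℚP.0≤p⇒∣p∣≡p 0≤q)

applySigns : ∀ {p} → Vec Bool p → Vec ℚ p → Vec ℚ p
applySigns = zipWith applySign

applySigns-signs-∣∣ : ∀ {p} (xs : Vec ℚ p) → applySigns (Vec.map signOf xs) (Vec.map ℚ.∣_∣ xs) ≡ xs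
applySigns-signs-∣∣ [] = refl
applySigns-signs-∣∣ (x ∷ xs) = cong₂ _∷_ (applySign-signOf-∣∣ x) (applySigns-signs-∣∣ xs)

∣applySigns∣ : ∀ {p} (ε : Vec Bool p) ys → NonNeg ys → Vec.map ℚ.∣_∣ (applySigns ε ys) ≡ ys
∣applySigns∣ [] [] _ = refl
∣applySigns∣ (s ∷ ε) (y ∷ ys) 0≤ys = cong₂ _∷_ (∣applySign∣ s (0≤ys zero)) (∣applySigns∣ ε ys (0≤ys ∘ suc))

splitVar : ∀ {p} → Bool → Fin p → NatPoly p × NatPoly p
splitVar true  i = var i , num 0
splitVar false i = num 0 , var i

splitSigns : ∀ {p} → Vec Bool p → Poly p → NatPoly p × NatPoly p
splitSigns ε (const (+ n))    = num n , num 0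
splitSigns ε (const -[1+ n ]) = num 0 , num (ℕ.suc n)
splitSigns ε (var i)          = splitVar (lookup ε i) i
splitSigns ε (a ⊕ b) =
  let (P₁ , Q₁) = splitSigns ε a ; (P₂ , Q₂) = splitSigns ε b
  in P₁ ⊞ P₂ , Q₁ ⊞ Q₂
splitSigns ε (a ⊗ b) =
  let (P₁ , Q₁) = splitSigns ε a ; (P₂ , Q₂) = splitSigns ε b
  in P₁ ⊠ P₂ ⊞ Q₁ ⊠ Q₂ , P₁ ⊠ Q₂ ⊞ Q₁ ⊠ P₂

evalDiff : ∀ {p} → NatPoly p × NatPoly p → Vec ℚ p → ℚ
evalDiff (P , Q) ys = evalNat P (lookup ys) ℚ.- evalNat Q (lookup ys)

module _ where
  open +-*-Solver

  q≡q-0 : ∀ q → q ≡ q ℚ.- 0ℚ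
  q≡q-0 = solve 1 (λ q → q := q :- con 0ℚ) refl

  -q≡0-q : ∀ q → ℚ.- q ≡ 0ℚ ℚ.- q
  -q≡0-q = solve 1 (λ q → :- q := con 0ℚ :- q) refl

  [a-b]+[c-d]≡[a+c]-[b+d] : ∀ a b c d → (a ℚ.- b) ℚ.+ (c ℚ.- d) ≡ (a ℚ.+ c) ℚ.- (b ℚ.+ d)
  [a-b]+[c-d]≡[a+c]-[b+d] = solve 4 (λ a b c d → (a :- b) :+ (c :- d) := (a :+ c) :- (b :+ d)) refl

  [a-b]*[c-d]≡[ac+bd]-[ad+bc] : ∀ a b c d →
    (a ℚ.- b) ℚ.* (c ℚ.- d) ≡ (a ℚ.* c ℚ.+ b ℚ.* d) ℚ.- (a ℚ.* d ℚ.+ b ℚ.* c)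
  [a-b]*[c-d]≡[ac+bd]-[ad+bc] =
    solve 4 (λ a b c d → (a :- b) :* (c :- d) := (a :* c :+ b :* d) :- (a :* d :+ b :* c)) refl

  a-b≡0⇒a≡b : ∀ {a b} → a ℚ.- b ≡ 0ℚ → a ≡ b
  a-b≡0⇒a≡b {a} {b} a-b≡0 = begin
    a                ≡⟨ solve 2 (λ a b → a := (a :- b) :+ b) refl a b ⟩
    (a ℚ.- b) ℚ.+ b  ≡⟨ cong (ℚ._+ b) a-b≡0 ⟩
    0ℚ ℚ.+ b         ≡⟨ ℚP.+-identityˡ b ⟩
    b                ∎
    where open ≡-Reasoning

splitVar-correct : ∀ {p} s (i : Fin p) ys → applySign s (lookup ys i) ≡ evalDiff (splitVar s i) ys
splitVar-correct true  i ys = q≡q-0 (lookup ys i)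
splitVar-correct false i ys = -q≡0-q (lookup ys i)

splitSigns-correct : ∀ {p} (ε : Vec Bool p) D ys → evalℚ D (applySigns ε ys) ≡ evalDiff (splitSigns ε D) ys
splitSigns-correct ε (const (+ n)) ys = q≡q-0 _
splitSigns-correct ε (const -[1+ n ]) ys = -q≡0-q _
splitSigns-correct ε (var i) ys =
  trans (VecP.lookup-zipWith applySign i ε ys) (splitVar-correct (lookup ε i) i ys)
splitSigns-correct ε (a ⊕ b) ys = trans
  (cong₂ ℚ._+_ (splitSigns-correct ε a ys) (splitSigns-correct ε b ys))
  ([a-b]+[c-d]≡[a+c]-[b+d] (ev P₁) (ev Q₁) (ev P₂) (ev Q₂))
  where
  ev = λ e → evalNat e (lookup ys)
  P₁ = proj₁ (splitSigns ε a); Q₁ = proj₂ (splitSigns ε a)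
  P₂ = proj₁ (splitSigns ε b); Q₂ = proj₂ (splitSigns ε b)
splitSigns-correct ε (a ⊗ b) ys = trans
  (cong₂ ℚ._*_ (splitSigns-correct ε a ys) (splitSigns-correct ε b ys))
  ([a-b]*[c-d]≡[ac+bd]-[ad+bc] (ev P₁) (ev Q₁) (ev P₂) (ev Q₂))
  where
  ev = λ e → evalNat e (lookup ys)
  P₁ = proj₁ (splitSigns ε a); Q₁ = proj₂ (splitSigns ε a)
  P₂ = proj₁ (splitSigns ε b); Q₂ = proj₂ (splitSigns ε b)

hℚ≤hVec : ∀ {n} (xs : Vec ℚ n) i → hℚ (lookup xs i) ≤ hVec xs
hℚ≤hVec (x ∷ xs) zero = ℕP.m≤m⊔n _ _
hℚ≤hVec (x ∷ xs) (suc i) = ℕP.≤-trans (hℚ≤hVec xs i) (ℕP.m≤n⊔m _ _)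

hVec≤ : ∀ {n} (xs : Vec ℚ n) {m} → (∀ i → hℚ (lookup xs i) ≤ m) → hVec xs ≤ m
hVec≤ [] _ = z≤n
hVec≤ (x ∷ xs) hxs≤m = ℕP.⊔-lub (hxs≤m zero) (hVec≤ xs (hxs≤m ∘ suc))

hVec-∣∣ : ∀ {n} (xs : Vec ℚ n) → hVec (Vec.map ℚ.∣_∣ xs) ≡ hVec xs
hVec-∣∣ [] = refl
hVec-∣∣ (mkℚ _ _ _ ∷ xs) = cong (_ ⊔_) (hVec-∣∣ xs)

hVec≤hVec-run : ∀ {k n} (P : Prog k n) xs → hVec xs ≤ hVec (run P xs)
hVec≤hVec-run P xs = hVec≤ xs λ j →
  subst (λ q → hℚ q ≤ _) (lookup-run-embed P xs j) (hℚ≤hVec (run P xs) (embed P j))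

maxOverSigns : ∀ p → (Vec Bool p → ℕ) → ℕ
maxOverSigns ℕ.zero g = g []
maxOverSigns (ℕ.suc p) g = maxOverSigns p (g ∘ (true ∷_)) ⊔ maxOverSigns p (g ∘ (false ∷_))

≤-maxOverSigns : ∀ {p} g (ε : Vec Bool p) → g ε ≤ maxOverSigns p g
≤-maxOverSigns g [] = ℕP.≤-refl
≤-maxOverSigns g (true ∷ ε) = ℕP.≤-trans (≤-maxOverSigns (g ∘ (true ∷_)) ε) (ℕP.m≤m⊔n _ _)
≤-maxOverSigns g (false ∷ ε) = ℕP.≤-trans (≤-maxOverSigns (g ∘ (false ∷_)) ε) (ℕP.m≤n⊔m _ _)

module Encoding {p} (D : Poly p) (ε : Vec Bool p) where

  P Q : NatPoly p
  P = proj₁ (splitSigns ε D)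
  Q = proj₂ (splitSigns ε D)

  -- After the first step the registers hold 0, 1 and then the unknowns.
  start : Prog p (2 ℕ.+ p)
  start = step zeroOne done

  oP : Compiled (2 ℕ.+ p)
  oP = compile P (2 ↑ʳ_) zero

  oQ : Compiled (size oP)
  oQ = compile Q (embed (program oP) ∘ (2 ↑ʳ_)) (embed (program oP) zero)

  n : ℕ
  n = size oQ

  prog : Prog p n
  prog = start ⨾ (program oP ⨾ program oQ)

  regP regOne regQ : Fin n
  regP = embed (program oQ) (result oP)
  regOne = embed (program oQ) (embed (program oP) (suc zero))
  regQ = result oQ

  -- G_n has no equation x_i = x_k, so P = Q is imposed as P · 1 = Q.
  system : GSystem n
  system = progEquations prog ++ₗ [ mulEq regP regOne regQ ]

  1≤n : 1 ≤ n
  1≤n = ℕP.≤-trans (s≤s z≤n) (Prog⇒≤ (program oP ⨾ program oQ))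

  module _ (ys : Vec ℚ p) where
    private
      ys₀ : Vec ℚ (2 ℕ.+ p)
      ys₀ = 0ℚ ∷ 1ℚ ∷ ys
      ys₁ : Vec ℚ (size oP)
      ys₁ = run (program oP) ys₀
      Pv Qv : ℚ
      Pv = evalNat P (lookup ys)
      Qv = evalNat Q (lookup ys)

    run-prog : run prog ys ≡ run (program oQ) ys₁
    run-prog = run-⨾ (program oP) (program oQ) ys₀

    value-regP : lookup (run prog ys) regP ≡ evalNat P (lookup ys)
    value-regP = begin
      lookup (run prog ys) regP            ≡⟨ cong (λ v → lookup v regP) run-prog ⟩
      lookup (run (program oQ) ys₁) regP   ≡⟨ lookup-run-embed (program oQ) ys₁ (result oP) ⟩
      value oP ys₀                         ≡⟨ compile-correct P (2 ↑ʳ_) zero ys₀ refl ⟩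
      evalNat P (lookup ys)                ∎
      where open ≡-Reasoning

    value-regQ : lookup (run prog ys) regQ ≡ evalNat Q (lookup ys)
    value-regQ = trans (cong (λ v → lookup v regQ) run-prog)
                       (compile-correct-second P Q (2 ↑ʳ_) zero ys₀ refl)

    value-regOne : lookup (run prog ys) regOne ≡ 1ℚ
    value-regOne = begin
      lookup (run prog ys) regOne                ≡⟨ cong (λ v → lookup v regOne) run-prog ⟩
      lookup (run (program oQ) ys₁) regOne       ≡⟨ lookup-run-embed (program oQ) ys₁ _ ⟩
      lookup ys₁ (embed (program oP) (suc zero)) ≡⟨ lookup-run-embed (program oP) ys₀ (suc zero) ⟩
      1ℚ                                         ∎
      where open ≡-Reasoning

    root⇒last-equation : RatSol D (applySigns ε ys) → SatG (run prog ys) (mulEq regP regOne regQ)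
    root⇒last-equation root = begin
      lookup (run prog ys) regP ℚ.* lookup (run prog ys) regOne ≡⟨ cong₂ ℚ._*_ value-regP value-regOne ⟩
      Pv ℚ.* 1ℚ                                                ≡⟨ ℚP.*-identityʳ Pv ⟩
      Pv                                                       ≡⟨ a-b≡0⇒a≡b Pv-Qv≡0 ⟩
      Qv                                                       ≡⟨ value-regQ ⟨
      lookup (run prog ys) regQ                                ∎
      where
      open ≡-Reasoning
      Pv-Qv≡0 : Pv ℚ.- Qv ≡ 0ℚ
      Pv-Qv≡0 = trans (sym (splitSigns-correct ε D ys)) root

    last-equation⇒root : SatG (run prog ys) (mulEq regP regOne regQ) → RatSol D (applySigns ε ys)
    last-equation⇒root P·1≡Q = begin
      evalℚ D (applySigns ε ys) ≡⟨ splitSigns-correct ε D ys ⟩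
      Pv ℚ.- Qv                 ≡⟨ cong (ℚ._- Qv) Pv≡Qv ⟩
      Qv ℚ.- Qv                 ≡⟨ ℚP.+-inverseʳ Qv ⟩
      0ℚ                        ∎
      where
      open ≡-Reasoning
      Pv≡Qv : Pv ≡ Qv
      Pv≡Qv = begin
        Pv                                                          ≡⟨ ℚP.*-identityʳ Pv ⟨
        Pv ℚ.* 1ℚ                                                   ≡⟨ cong₂ ℚ._*_ value-regP value-regOne ⟨
        lookup (run prog ys) regP ℚ.* lookup (run prog ys) regOne  ≡⟨ P·1≡Q ⟩
        lookup (run prog ys) regQ                                   ≡⟨ value-regQ ⟩
        Qv                                                          ∎

  root⇒solution : ∀ ys → NonNeg ys → RatSol D (applySigns ε ys) → NonNegSol system (run prog ys)
  root⇒solution ys 0≤ys root =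
    run-nonNeg prog 0≤ys , All.++⁺ (run-satisfies prog ys 0≤ys) (root⇒last-equation ys root ∷ [])

  solution⇒root : ∀ zs → NonNegSol system zs →
    let ys = restrict prog zs in zs ≡ run prog ys × NonNeg ys × RatSol D (applySigns ε ys)
  solution⇒root zs (0≤zs , sat) = zs≡run , 0≤ys , last-equation⇒root ys last
    where
    ys = restrict prog zs
    zs≡run = run-unique prog zs 0≤zs (All.++⁻ˡ _ sat)
    0≤ys : NonNeg ys
    0≤ys j = subst (0ℚ ℚ.≤_) (sym (lookup-restrict prog zs j)) (0≤zs (embed prog j))
    last : SatG (run prog ys) (mulEq regP regOne regQ)
    last with All.++⁻ʳ (progEquations prog) sat
    ... | P·1≡Q ∷ [] = subst (λ v → SatG v (mulEq regP regOne regQ)) zs≡run P·1≡Q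

  system-finitelyMany : FinitelyMany (RatSol D) → FinitelyMany (NonNegSol system)
  system-finitelyMany (xss , complete) = map encode xss , λ zs sol →
    let zs≡run , 0≤ys , root = solution⇒root zs sol
        ys = restrict prog zs
    in subst (_∈ map encode xss)
         (trans (cong (run prog) (∣applySigns∣ ε ys 0≤ys)) (sym zs≡run))
         (∈-map⁺ encode (complete (applySigns ε ys) root))
    where
    encode : Vec ℚ p → Vec ℚ n
    encode = run prog ∘ Vec.map ℚ.∣_∣

  hVec-root≤ : Conjecture2 → FinitelyMany (RatSol D) →
    ∀ ys → NonNeg ys → RatSol D (applySigns ε ys) → hVec ys ≤ f (2 ℕ.* n)
  hVec-root≤ conjecture finite ys 0≤ys root = ℕP.≤-trans (hVec≤hVec-run prog ys)
    (conjecture n 1≤n system (system-finitelyMany finite) (run prog ys) (root⇒solution ys 0≤ys root))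

heightBound : (p : ℕ) → Poly p → ℕ
heightBound p D = maxOverSigns p λ ε → f (2 ℕ.* Encoding.n D ε)

theorem7 : Σ ((p : ℕ) → Poly p → ℕ) λ bound →
    Conjecture2 → (p : ℕ) → (D : Poly p) → FinitelyMany (RatSol D) →
    (x : Vec ℚ p) → RatSol D x → hVec x ≤ bound p D
theorem7 = heightBound , λ conjecture p D finite x root →
  let ε = Vec.map signOf x
      ∣x∣ = Vec.map ℚ.∣_∣ x
      0≤∣x∣ : NonNeg ∣x∣
      0≤∣x∣ j = subst (0ℚ ℚ.≤_) (sym (VecP.lookup-map j ℚ.∣_∣ x)) (ℚP.0≤∣p∣ (lookup x j))
      root′ : RatSol D (applySigns ε ∣x∣)
      root′ = subst (RatSol D) (sym (applySigns-signs-∣∣ x)) root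
  in begin
    hVec x                       ≡⟨ hVec-∣∣ x ⟨
    hVec ∣x∣                     ≤⟨ Encoding.hVec-root≤ D ε conjecture finite ∣x∣ 0≤∣x∣ root′ ⟩
    f (2 ℕ.* Encoding.n D ε)     ≤⟨ ≤-maxOverSigns (λ ε → f (2 ℕ.* Encoding.n D ε)) ε ⟩
    heightBound p D              ∎
  where open ℕP.≤-Reasoning
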